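{- Let $S = \{l_0,l_1\}\times\mathbb{N}^2$ with the discrete $\sigma$-algebra, writing states as $(l,m,n)$, and let $F$ be the deterministic Markov chain with $F(l_0,m,n) = \delta_{(l_1,n,n)}$, $F(l_1,m,n) = \delta_{(l_1,m-1,n)}$ if $m>0$, and $F(l_1,0,n) = \delta_{(l_0,0,n+1)}$. Let $A = \{l_1\}\times\mathbb{N}^2$ and $B = \{l_0\}\times\mathbb{N}^2$. Then there is no Streett supermartingale for $(F,(A,B))$, i.e. there is no function $r : S\to[0,\infty)$ together with constants $\epsilon, M > 0$ such that for every $x\in S$, \[ (\mathbb{X}r)(x) \le r(x) - \epsilon\,\chi_{A\setminus B}(x) + M\,\chi_B(x). \]
   Context: $\delta_s$ is the Dirac distribution at $s$; the next-time operator is $(\mathbb{X}r)(x) = \int r\,dF_x$, so here $(\mathbb{X}r)(x) = r(y)$ where $F(x)=\delta_y$. $\chi_C$ denotes the indicator function of a set $C$. (This Markov chain models the program: while true do { m := n; while m > 0 do m := m - 1; n := n + 1 }.) -}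

module Defs where

open import Data.Nat using (ℕ; zero; suc)
open import Data.Bool using (Bool; true; false; if_then_else_; _∧_; not)
open import Data.Product using (Σ; ∃; _×_; _,_)
open import Data.Sum using (_⊎_)
open import Relation.Binary.PropositionalEquality using (_≡_; _≢_)
open import Relation.Nullary using (¬_)

-- The real numbers, given axiomatically as a complete ordered field.
-- (agda-stdlib has no reals; every model of this record is isomorphic
-- to ℝ, so quantifying over all models states the claim for ℝ.)

record Reals : Set₁ where
  infixl 6 _+_ _-_
  infixl 7 _*_
  infix 4 _≤_ _<_
  field
    Carrier : Set
    0ℝ 1ℝ   : Carrier
    _+_ _*_ : Carrier → Carrier → Carrier
    -_      : Carrier → Carrier
    _≤_     : Carrier → Carrier → Set
    +-assoc  : ∀ x y z → (x + y) + z ≡ x + (y + z)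
    +-comm   : ∀ x y → x + y ≡ y + x
    +-idʳ    : ∀ x → x + 0ℝ ≡ x
    +-invʳ   : ∀ x → x + (- x) ≡ 0ℝ
    *-assoc  : ∀ x y z → (x * y) * z ≡ x * (y * z)
    *-comm   : ∀ x y → x * y ≡ y * x
    *-idʳ    : ∀ x → x * 1ℝ ≡ x
    *-invʳ   : ∀ x → x ≢ 0ℝ → Σ Carrier (λ y → x * y ≡ 1ℝ)
    distribˡ : ∀ x y z → x * (y + z) ≡ x * y + x * z
    0≢1      : 0ℝ ≢ 1ℝ
    ≤-refl    : ∀ x → x ≤ x
    ≤-antisym : ∀ {x y} → x ≤ y → y ≤ x → x ≡ y
    ≤-trans   : ∀ {x y z} → x ≤ y → y ≤ z → x ≤ z
    ≤-total   : ∀ x y → x ≤ y ⊎ y ≤ x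
    +-mono-≤  : ∀ {x y} z → x ≤ y → x + z ≤ y + z
    *-nonneg  : ∀ {x y} → 0ℝ ≤ x → 0ℝ ≤ y → 0ℝ ≤ x * y
    lub : (P : Carrier → Set) → Σ Carrier P →
          Σ Carrier (λ b → ∀ x → P x → x ≤ b) →
          Σ Carrier (λ s → (∀ x → P x → x ≤ s) ×
                           (∀ b → (∀ x → P x → x ≤ b) → s ≤ b))

  _<_ : Carrier → Carrier → Set
  x < y = x ≤ y × x ≢ y

  _-_ : Carrier → Carrier → Carrier
  x - y = x + (- y)

-- The Markov chain of the program
--   while true do { m := n; while m > 0 do m := m - 1; n := n + 1 }

data Loc : Set where
  l₀ l₁ : Loc

S : Set
S = Loc × ℕ × ℕ

-- F is deterministic: F x = δ_(step x)
step : S → S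
step (l₀ , m , n)     = (l₁ , n , n)
step (l₁ , suc m , n) = (l₁ , m , n)
step (l₁ , zero , n)  = (l₀ , zero , suc n)

inA : S → Bool
inA (l₀ , _) = false
inA (l₁ , _) = true

inB : S → Bool
inB (l₀ , _) = true
inB (l₁ , _) = false

inA∖B : S → Bool
inA∖B x = inA x ∧ not (inB x)

module _ (ℝ : Reals) where
  open Reals ℝ

  χ : (S → Bool) → S → Carrier
  χ C x = if C x then 1ℝ else 0ℝ

  -- next-time operator: (𝕏 r)(x) = ∫ r dF_x = r (step x) since F x = δ_(step x)
  𝕏 : (S → Carrier) → S → Carrier
  𝕏 r x = r (step x)

  StreettSupermartingale : Set
  StreettSupermartingale =
    Σ (S → Carrier) λ r → Σ Carrier λ ε → Σ Carrier λ M →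
      (∀ x → 0ℝ ≤ r x) × (0ℝ < ε) × (0ℝ < M) ×
      (∀ x → 𝕏 r x ≤ r x - ε * χ inA∖B x + M * χ inB x)

-- Along the inner countdown loop r drops by ε per step, so one round trip from
-- (l₀, 0, n) to (l₀, 0, n + 1) lowers r by (n + 1)ε while the single visit to B
-- raises it by at most M. Once nε ≥ M (Archimedes) the values r (l₀, 0, n) must
-- therefore decrease by ε forever, which is impossible for a nonnegative sequence.
module Submission where

open import Data.Nat using (ℕ; zero; suc) renaming (_+_ to _+ℕ_)
open import Data.Product using (Σ; _×_; _,_; proj₁; proj₂)
open import Data.Sum using ([_,_]′)
open import Data.Empty using (⊥-elim)
open import Function using (id)
open import Relation.Binary.Bundles using (Poset)
open import Relation.Binary.PropositionalEquality
  using (_≡_; refl; sym; trans; cong; cong₂; isEquivalence)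
open import Relation.Nullary using (¬_)

open import Defs

module OrderedFieldProperties (ℝ : Reals) where
  open Reals ℝ

  ≤-reflexive : ∀ {x y} → x ≡ y → x ≤ y
  ≤-reflexive refl = ≤-refl _

  ≤-poset : Poset _ _ _
  ≤-poset = record
    { Carrier        = Carrier
    ; _≈_            = _≡_
    ; _≤_            = _≤_
    ; isPartialOrder = record
      { isPreorder = record
        { isEquivalence = isEquivalence
        ; reflexive     = ≤-reflexive
        ; trans         = ≤-trans
        }
      ; antisym = ≤-antisym
      }
    }

  open import Relation.Binary.Reasoning.PartialOrder ≤-poset public

  +-identityˡ : ∀ x → 0ℝ + x ≡ x
  +-identityˡ x = trans (+-comm 0ℝ x) (+-idʳ x)

  x+z-z≡x : ∀ x z → x + z - z ≡ x
  x+z-z≡x x z = trans (+-assoc x z (- z)) (trans (cong (x +_) (+-invʳ z)) (+-idʳ x))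

  x-z+z≡x : ∀ x z → x - z + z ≡ x
  x-z+z≡x x z = trans (+-assoc x (- z) z)
    (trans (cong (x +_) (trans (+-comm (- z) z) (+-invʳ z))) (+-idʳ x))

  x+[y+z]≡x+z+y : ∀ x y z → x + (y + z) ≡ x + z + y
  x+[y+z]≡x+z+y x y z = trans (cong (x +_) (+-comm y z)) (sym (+-assoc x z y))

  +-monoʳ-≤ : ∀ {x y} z → x ≤ y → z + x ≤ z + y
  +-monoʳ-≤ {x} {y} z x≤y = begin
    z + x ≡⟨ +-comm z x ⟩
    x + z ≤⟨ +-mono-≤ z x≤y ⟩
    y + z ≡⟨ +-comm y z ⟩
    z + y ∎

  +-cancelʳ-≤ : ∀ {x y} z → x + z ≤ y + z → x ≤ y
  +-cancelʳ-≤ {x} {y} z x+z≤y+z = begin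
    x         ≡⟨ sym (x+z-z≡x x z) ⟩
    x + z - z ≤⟨ +-mono-≤ (- z) x+z≤y+z ⟩
    y + z - z ≡⟨ x+z-z≡x y z ⟩
    y         ∎

  x≤x+y : ∀ {y} x → 0ℝ ≤ y → x ≤ x + y
  x≤x+y x 0≤y = begin
    x      ≡⟨ sym (+-idʳ x) ⟩
    x + 0ℝ ≤⟨ +-monoʳ-≤ x 0≤y ⟩
    x + _  ∎

  *-zeroʳ : ∀ x → x * 0ℝ ≡ 0ℝ
  *-zeroʳ x = begin-equality
    x * 0ℝ                   ≡⟨ sym (x+z-z≡x (x * 0ℝ) (x * 0ℝ)) ⟩
    x * 0ℝ + x * 0ℝ - x * 0ℝ ≡⟨ cong (_- x * 0ℝ) (sym (distribˡ x 0ℝ 0ℝ)) ⟩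
    x * (0ℝ + 0ℝ) - x * 0ℝ   ≡⟨ cong (λ t → x * t - x * 0ℝ) (+-idʳ 0ℝ) ⟩
    x * 0ℝ - x * 0ℝ          ≡⟨ +-invʳ (x * 0ℝ) ⟩
    0ℝ                       ∎

  x-0≡x : ∀ x → x - 0ℝ ≡ x
  x-0≡x x = trans (cong (x +_) -0≡0) (+-idʳ x)
    where
    -0≡0 : - 0ℝ ≡ 0ℝ
    -0≡0 = trans (sym (+-identityˡ (- 0ℝ))) (+-invʳ 0ℝ)

  infixr 8 _·_

  _·_ : ℕ → Carrier → Carrier
  zero  · x = 0ℝ
  suc n · x = n · x + x

  m·x≤[k+m]·x : ∀ {x} → 0ℝ ≤ x → ∀ k m → m · x ≤ (k +ℕ m) · x
  m·x≤[k+m]·x 0≤x zero    m = ≤-refl _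
  m·x≤[k+m]·x 0≤x (suc k) m = ≤-trans (m·x≤[k+m]·x 0≤x k m) (x≤x+y _ 0≤x)

  -- The least upper bound s of the multiples of ε is also bounded by s - ε.
  archimedean : ∀ {ε} → 0ℝ < ε → ∀ c → ¬ (∀ n → n · ε ≤ c)
  archimedean {ε} (0≤ε , 0≢ε) c bounded = 0≢ε (≤-antisym 0≤ε ε≤0)
    where
    IsMultiple : Carrier → Set
    IsMultiple x = Σ ℕ λ n → x ≡ n · ε

    IsUpperBound : Carrier → Set
    IsUpperBound b = ∀ x → IsMultiple x → x ≤ b

    sup : Σ Carrier λ s → IsUpperBound s × (∀ b → IsUpperBound b → s ≤ b)
    sup = lub IsMultiple (0ℝ , zero , refl) (c , λ { _ (n , refl) → bounded n })

    s : Carrier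
    s = proj₁ sup

    s-ε-bounds-multiples : IsUpperBound (s - ε)
    s-ε-bounds-multiples _ (n , refl) = begin
      n · ε         ≡⟨ sym (x+z-z≡x (n · ε) ε) ⟩
      suc n · ε - ε ≤⟨ +-mono-≤ (- ε) (proj₁ (proj₂ sup) _ (suc n , refl)) ⟩
      s - ε         ∎

    ε≤0 : ε ≤ 0ℝ
    ε≤0 = +-cancelʳ-≤ s (begin
      ε + s     ≡⟨ +-comm ε s ⟩
      s + ε     ≤⟨ +-mono-≤ ε (proj₂ (proj₂ sup) _ s-ε-bounds-multiples) ⟩
      s - ε + ε ≡⟨ x-z+z≡x s ε ⟩
      s         ≡⟨ sym (+-identityˡ s) ⟩
      0ℝ + s    ∎)

  archimedean-¬¬ : ∀ {ε} → 0ℝ < ε → ∀ c → ¬ (∀ n → ¬ (c ≤ n · ε))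
  archimedean-¬¬ {ε} 0<ε c never = archimedean 0<ε c λ n →
    [ id , (λ c≤nε → ⊥-elim (never n c≤nε)) ]′ (≤-total (n · ε) c)

  no-nonneg-descent : ∀ {ε} → 0ℝ < ε → (a : ℕ → Carrier) → (∀ n → 0ℝ ≤ a n) →
                      ¬ (∀ n → a (suc n) + ε ≤ a n)
  no-nonneg-descent {ε} 0<ε a a≥0 descent = archimedean 0<ε (a 0) λ n → begin
    n · ε       ≡⟨ sym (+-identityˡ (n · ε)) ⟩
    0ℝ + n · ε  ≤⟨ +-mono-≤ (n · ε) (a≥0 n) ⟩
    a n + n · ε ≤⟨ total-drop n ⟩
    a 0         ∎
    where
    total-drop : ∀ n → a n + n · ε ≤ a 0
    total-drop zero    = ≤-reflexive (+-idʳ (a 0))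
    total-drop (suc n) = begin
      a (suc n) + (n · ε + ε) ≡⟨ x+[y+z]≡x+z+y (a (suc n)) (n · ε) ε ⟩
      a (suc n) + ε + n · ε   ≤⟨ +-mono-≤ (n · ε) (descent n) ⟩
      a n + n · ε             ≤⟨ total-drop n ⟩
      a 0                     ∎

  -- Past an index N with M ≤ N · ε the recurrence forces a descent by ε.
  no-nonneg-sequence-with-growing-drops :
    ∀ {ε} M → 0ℝ < ε → (a : ℕ → Carrier) → (∀ n → 0ℝ ≤ a n) →
    ¬ (∀ n → a (suc n) + suc n · ε ≤ a n + M)
  no-nonneg-sequence-with-growing-drops {ε} M 0<ε a a≥0 recurrence =
    archimedean-¬¬ 0<ε M λ N M≤Nε →
      no-nonneg-descent 0<ε (λ k → a (k +ℕ N)) (λ k → a≥0 (k +ℕ N))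
        λ k → descent-beyond N M≤Nε k
    where
    descent-beyond : ∀ N → M ≤ N · ε → ∀ k → a (suc k +ℕ N) + ε ≤ a (k +ℕ N)
    descent-beyond N M≤Nε k = +-cancelʳ-≤ M (begin
      a (suc j) + ε + M     ≡⟨ +-assoc (a (suc j)) ε M ⟩
      a (suc j) + (ε + M)   ≡⟨ cong (a (suc j) +_) (+-comm ε M) ⟩
      a (suc j) + (M + ε)   ≤⟨ +-monoʳ-≤ (a (suc j)) (+-mono-≤ ε M≤jε) ⟩
      a (suc j) + suc j · ε ≤⟨ recurrence j ⟩
      a j + M               ∎)
      where
      j : ℕ
      j = k +ℕ N

      M≤jε : M ≤ j · ε
      M≤jε = ≤-trans M≤Nε (m·x≤[k+m]·x (proj₁ 0<ε) k N)

module StreettSupermartingaleOnProgram (ℝ : Reals) where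
  open Reals ℝ
  open OrderedFieldProperties ℝ

  module _ {r : S → Carrier} {ε M : Carrier}
           (super : ∀ x → 𝕏 ℝ r x ≤ r x - ε * χ ℝ inA∖B x + M * χ ℝ inB x) where

    enter-countdown : ∀ n → r (l₁ , n , n) ≤ r (l₀ , zero , n) + M
    enter-countdown n = begin
      r (l₁ , n , n)      ≤⟨ super (l₀ , zero , n) ⟩
      a - ε * 0ℝ + M * 1ℝ ≡⟨ cong (λ t → a - t + M * 1ℝ) (*-zeroʳ ε) ⟩
      a - 0ℝ + M * 1ℝ     ≡⟨ cong₂ _+_ (x-0≡x a) (*-idʳ M) ⟩
      a + M               ∎
      where
      a : Carrier
      a = r (l₀ , zero , n)

    countdown-step : ∀ m n → r (step (l₁ , m , n)) + ε ≤ r (l₁ , m , n)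
    countdown-step m n = begin
      r (step x) + ε             ≤⟨ +-mono-≤ ε (super x) ⟩
      r x - ε * 1ℝ + M * 0ℝ + ε  ≡⟨ cong (λ t → r x - ε * 1ℝ + t + ε) (*-zeroʳ M) ⟩
      r x - ε * 1ℝ + 0ℝ + ε      ≡⟨ cong (_+ ε) (+-idʳ (r x - ε * 1ℝ)) ⟩
      r x - ε * 1ℝ + ε           ≡⟨ cong (λ t → r x - t + ε) (*-idʳ ε) ⟩
      r x - ε + ε                ≡⟨ x-z+z≡x (r x) ε ⟩
      r x                        ∎
      where
      x : S
      x = l₁ , m , n

    countdown : ∀ m n → r (l₁ , zero , n) + m · ε ≤ r (l₁ , m , n)
    countdown zero    n = ≤-reflexive (+-idʳ _)
    countdown (suc m) n = begin
      r (l₁ , zero , n) + (m · ε + ε) ≡⟨ sym (+-assoc _ (m · ε) ε) ⟩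
      r (l₁ , zero , n) + m · ε + ε   ≤⟨ +-mono-≤ ε (countdown m n) ⟩
      r (l₁ , m , n) + ε              ≤⟨ countdown-step (suc m) n ⟩
      r (l₁ , suc m , n)              ∎

    round-trip : ∀ n → r (l₀ , zero , suc n) + suc n · ε ≤ r (l₀ , zero , n) + M
    round-trip n = begin
      r (l₀ , zero , suc n) + (n · ε + ε) ≡⟨ x+[y+z]≡x+z+y _ (n · ε) ε ⟩
      r (l₀ , zero , suc n) + ε + n · ε   ≤⟨ +-mono-≤ (n · ε) (countdown-step zero n) ⟩
      r (l₁ , zero , n) + n · ε           ≤⟨ countdown n n ⟩
      r (l₁ , n , n)                      ≤⟨ enter-countdown n ⟩
      r (l₀ , zero , n) + M               ∎

proposition3p10 : (ℝ : Reals) → ¬ StreettSupermartingale ℝ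
proposition3p10 ℝ (r , ε , M , r≥0 , 0<ε , _ , super) =
  no-nonneg-sequence-with-growing-drops M 0<ε (λ n → r (l₀ , zero , n)) (λ n → r≥0 _)
    (round-trip super)
  where
  open OrderedFieldProperties ℝ
  open StreettSupermartingaleOnProgram ℝ
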